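{- Let $f_1,\ldots,f_s:\mathbb{R}\to\mathbb{R}$ be $\mathbb{Z}$-convex functions with minimum at $0$, and let $A\in\mathbb{Z}^{d\times n}$, $b\in\mathbb{Z}^d$, $c\in\mathbb{R}^n$, $c_1,\ldots,c_s\in\mathbb{Z}^n$, $c_{1,0},\ldots,c_{s,0}\in\mathbb{Z}$. Fix $z\in\mathbb{Z}_+^n$ with $Az=b$ and fix an integer $k\ge\max\{|c_i^\intercal z+c_{i,0}|: i=1,\ldots,s\}$. Then, with $z$ held fixed, the optimal value of \[ \min\Big\{\sum_{i=1}^s\sum_{j=1}^k (f_i(j)-f_i(j-1))x_{i,j}+(f_i(-j)-f_i(-j+1))y_{i,j}+c^\intercal z:\ c_i^\intercal z+c_{i,0}=\sum_{j=1}^k x_{i,j}-\sum_{j=1}^k y_{i,j}\ (i=1,\ldots,s),\ x_{i,j},y_{i,j}\in\{0,1\}\Big\} \] (minimizing over the $x_{i,j},y_{i,j}$) equals $f(z)-\sum_{i=1}^s f_i(0)$, where $f(z):=\sum_{i=1}^s f_i(c_i^\intercal z+c_{i,0})+c^\intercal z$.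
   Context: A function $g:\mathbb{R}\to\mathbb{R}$ is called $\mathbb{Z}$-convex with minimum at $0$ if the function $x\mapsto g(x+1)-g(x)$ is increasing (non-decreasing) on $\mathbb{Z}$, $g(x+1)-g(x)\le 0$ for all integers $x<0$, and $g(x+1)-g(x)\ge 0$ for all integers $x\ge 0$. $\mathbb{Z}_+$ denotes the nonnegative integers. -}

module Defs where

open import Level using (Level; _⊔_; suc)
open import Data.Nat using (ℕ; zero; suc)
open import Data.Fin using (Fin; toℕ)
open import Data.Integer using (ℤ; +_; _+_; _-_; -_; _*_; _<_; _≤_; ∣_∣; 0ℤ; 1ℤ)
open import Data.Bool using (Bool; true; false; if_then_else_)
open import Data.Product using (Σ; _×_; ∃; ∃-syntax; _,_)
open import Relation.Binary.PropositionalEquality using (_≡_)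
open import Relation.Binary.Structures using (IsTotalOrder)
open import Algebra.Bundles using (AbelianGroup)

-- Used in place of (ℝ, +, ≤): the statement only adds, subtracts and
-- compares real values (and takes ℕ-multiples for cᵀz with z ∈ ℤ₊ⁿ).
record OrderedAbelianGroup (a ℓ₁ ℓ₂ : Level) : Set (Level.suc (a ⊔ ℓ₁ ⊔ ℓ₂)) where
  field
    abelianGroup : AbelianGroup a ℓ₁
  open AbelianGroup abelianGroup public
  field
    _≤ᴳ_ : Carrier → Carrier → Set ℓ₂
    isTotalOrder : IsTotalOrder _≈_ _≤ᴳ_
    ∙-mono-≤ : ∀ {x y} z → x ≤ᴳ y → (x ∙ z) ≤ᴳ (y ∙ z)

Σℤ : (n : ℕ) → (Fin n → ℤ) → ℤ
Σℤ zero    f = 0ℤ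
Σℤ (suc n) f = f Fin.zero + Σℤ n (λ i → f (Fin.suc i))
  where import Data.Fin as Fin

count : (n : ℕ) → (Fin n → Bool) → ℤ
count n x = Σℤ n (λ j → if x j then 1ℤ else 0ℤ)

module _ {a ℓ₁ ℓ₂} (G : OrderedAbelianGroup a ℓ₁ ℓ₂) where
  open OrderedAbelianGroup G using (Carrier; _∙_; ε; _⁻¹; _≤ᴳ_)

  ΣG : (n : ℕ) → (Fin n → Carrier) → Carrier
  ΣG zero    f = ε
  ΣG (suc n) f = f Fin.zero ∙ ΣG n (λ i → f (Fin.suc i))
    where import Data.Fin as Fin

  _·_ : ℕ → Carrier → Carrier
  zero  · g = ε
  suc m · g = g ∙ (m · g)

  _-ᴳ_ : Carrier → Carrier → Carrier
  x -ᴳ y = x ∙ (y ⁻¹)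

  Δ : (ℤ → Carrier) → ℤ → Carrier
  Δ g x = g (x + 1ℤ) -ᴳ g x

  -- ℤ-convex with minimum at 0 (g only matters on ℤ)
  record ZConvexMin0 (g : ℤ → Carrier) : Set (a ⊔ ℓ₂) where
    field
      increasing : ∀ x y → x ≤ y → Δ g x ≤ᴳ Δ g y
      nonpos-neg : ∀ x → x < 0ℤ → Δ g x ≤ᴳ ε
      nonneg-nonneg : ∀ x → 0ℤ ≤ x → ε ≤ᴳ Δ g x

linForm : (n : ℕ) → (Fin n → ℤ) → ℤ → (Fin n → ℕ) → ℤ
linForm n ci ci0 z = Σℤ n (λ j → ci j * + z j) + ci0

module Problem {a ℓ₁ ℓ₂} (G : OrderedAbelianGroup a ℓ₁ ℓ₂)
  (n s k : ℕ)
  (f : Fin s → ℤ → OrderedAbelianGroup.Carrier G)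
  (c : Fin n → OrderedAbelianGroup.Carrier G)
  (C : Fin s → Fin n → ℤ) (C0 : Fin s → ℤ)
  (z : Fin n → ℕ) where
  open OrderedAbelianGroup G using (Carrier; _∙_; ε; _≈_; _≤ᴳ_)

  cz : Carrier
  cz = ΣG G n (λ j → _·_ G (z j) (c j))

  -- objective; index j : Fin k stands for j' = toℕ j + 1 ∈ {1,…,k}
  objective : (Fin s → Fin k → Bool) → (Fin s → Fin k → Bool) → Carrier
  objective x y =
    ΣG G s (λ i → ΣG G k (λ j →
      (if x i j then _-ᴳ_ G (f i (+ (toℕ j) + 1ℤ)) (f i (+ (toℕ j))) else ε)
      ∙ (if y i j then _-ᴳ_ G (f i (- (+ (toℕ j) + 1ℤ))) (f i (- (+ (toℕ j)))) else ε)))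
    ∙ cz

  feasible : (Fin s → Fin k → Bool) → (Fin s → Fin k → Bool) → Set
  feasible x y = ∀ i → linForm n (C i) (C0 i) z ≡ count k (x i) - count k (y i)

  target : Carrier
  target = _-ᴳ_ G (ΣG G s (λ i → f i (linForm n (C i) (C0 i) z)) ∙ cz)
                  (ΣG G s (λ i → f i 0ℤ))

  OptimalValueIs : Carrier → Set (ℓ₁ ⊔ ℓ₂)
  OptimalValueIs v =
    (∃[ x ] ∃[ y ] (feasible x y × objective x y ≈ v))
    × (∀ x y → feasible x y → v ≤ᴳ objective x y)

-- The objective splits into one summand per i, depending only on (x_i, y_i).
-- Convexity makes the unit increments f(j+1) - f(j) and f(-j-1) - f(-j) (j ≥ 0)
-- nondecreasing in j, and the minimum at 0 makes them nonnegative. So a 0/1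
-- vector x with p ones costs at least the first p increments, which telescope to
-- f(p) - f(0); likewise y with q ones costs at least f(-q) - f(0). As f is
-- monotone on both half-lines, f(p) + f(-q) ≥ f(p - q) + f(0), so the i-th
-- summand is at least f_i(L_i) - f_i(0), where L_i = c_iᵀz + c_{i,0} = p - q.
-- Taking the first |L_i| ≤ k unit steps on the side of the sign of L_i attains it.

{-# OPTIONS --safe #-}
module Submission where

open import Defs
open import Level using (Level)
open import Data.Nat using (ℕ)
open import Data.Fin using (Fin)
open import Data.Integer using (ℤ; +_; _≤_; ∣_∣)
open import Relation.Binary.PropositionalEquality using (_≡_)

import Algebra.Properties.AbelianGroup as AbelianGroupProperties
import Algebra.Properties.CommutativeSemigroup as CommutativeSemigroupProperties
open import Data.Bool.Base using (Bool; true; false; if_then_else_)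
open import Data.Fin.Base using (toℕ; zero; suc)
open import Data.Integer.Base as ℤ using (-[1+_]; 0ℤ; 1ℤ; -_; _⊖_; +≤+; -≤-; -<+)
import Data.Integer.Properties as ℤ
open import Data.Nat.Base as ℕ using (zero; suc; z≤n; s≤s; _<ᵇ_; _∸_; _≤′_; ≤′-refl; ≤′-step)
import Data.Nat.Properties as ℕ
open import Data.Product.Base using (_,_)
open import Data.Sum.Base using (inj₁; inj₂)
open import Function.Base using (_∘_)
open import Relation.Binary.Bundles using (Poset)
import Relation.Binary.PropositionalEquality as ≡
open import Relation.Binary.Structures using (IsTotalOrder)

trues : ∀ {k} → (Fin k → Bool) → ℕ
trues {zero}  x = 0
trues {suc k} x = if x zero then suc (trues (x ∘ suc)) else trues (x ∘ suc)

count≡trues : ∀ k (x : Fin k → Bool) → count k x ≡ + trues x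
count≡trues zero    x = ≡.refl
count≡trues (suc k) x with x zero
... | true  = ≡.cong (λ t → 1ℤ ℤ.+ t) (count≡trues k (x ∘ suc))
... | false = ≡.trans (ℤ.+-identityˡ _) (count≡trues k (x ∘ suc))

initialSegment : ∀ {k} → ℕ → Fin k → Bool
initialSegment m j = toℕ j <ᵇ m

trues-initialSegment : ∀ {k m} → m ℕ.≤ k → trues (initialSegment {k} m) ≡ m
trues-initialSegment {zero}  z≤n       = ≡.refl
trues-initialSegment {suc k} z≤n       = trues-initialSegment {k} z≤n
trues-initialSegment {suc k} (s≤s m≤k) = ≡.cong suc (trues-initialSegment m≤k)

count-initialSegment : ∀ {k m} → m ℕ.≤ k → count k (initialSegment m) ≡ + m
count-initialSegment {k} m≤k = ≡.trans (count≡trues k _) (≡.cong +_ (trues-initialSegment m≤k))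

positiveSteps : ∀ {k} → ℤ → Fin k → Bool
positiveSteps (+ m)    = initialSegment m
positiveSteps -[1+ m ] = initialSegment 0

negativeSteps : ∀ {k} → ℤ → Fin k → Bool
negativeSteps (+ m)    = initialSegment 0
negativeSteps -[1+ m ] = initialSegment (suc m)

count-steps : ∀ {k} L → ∣ L ∣ ℕ.≤ k → L ≡ count k (positiveSteps L) ℤ.- count k (negativeSteps L)
count-steps {k} (+ m)    m≤k = ≡.sym (≡.trans
  (≡.cong₂ ℤ._-_ (count-initialSegment m≤k) (count-initialSegment {k} z≤n)) (ℤ.+-identityʳ (+ m)))
count-steps {k} -[1+ m ] m<k =
  ≡.sym (≡.cong₂ ℤ._-_ (count-initialSegment {k} z≤n) (count-initialSegment m<k))

module OrderedAbelianGroupProperties {a ℓ₁ ℓ₂ : Level} (G : OrderedAbelianGroup a ℓ₁ ℓ₂) where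
  open OrderedAbelianGroup G public renaming (_≤ᴳ_ to infix 4 _≤ᴳ_)
  open AbelianGroupProperties abelianGroup public
  open CommutativeSemigroupProperties commutativeSemigroup public

  poset : Poset a ℓ₁ ℓ₂
  poset = record { isPartialOrder = IsTotalOrder.isPartialOrder isTotalOrder }

  open import Relation.Binary.Reasoning.PartialOrder poset public

  ≤ᴳ-refl : ∀ {x} → x ≤ᴳ x
  ≤ᴳ-refl = IsTotalOrder.refl isTotalOrder

  ∙-mono₂-≤ : ∀ {x y u v} → x ≤ᴳ y → u ≤ᴳ v → x ∙ u ≤ᴳ y ∙ v
  ∙-mono₂-≤ {x} {y} {u} {v} x≤y u≤v = begin
    x ∙ u  ≤⟨ ∙-mono-≤ u x≤y ⟩
    y ∙ u  ≈⟨ comm y u ⟩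
    u ∙ y  ≤⟨ ∙-mono-≤ y u≤v ⟩
    v ∙ y  ≈⟨ comm v y ⟩
    y ∙ v  ∎

  x≤x∙y : ∀ {x y} → ε ≤ᴳ y → x ≤ᴳ x ∙ y
  x≤x∙y {x} {y} ε≤y = begin
    x      ≈⟨ identityʳ x ⟨
    x ∙ ε  ≤⟨ ∙-mono₂-≤ ≤ᴳ-refl ε≤y ⟩
    x ∙ y  ∎

  x≤y∙x : ∀ {x y} → ε ≤ᴳ y → x ≤ᴳ y ∙ x
  x≤y∙x {x} {y} ε≤y = begin
    x      ≈⟨ identityˡ x ⟨
    ε ∙ x  ≤⟨ ∙-mono-≤ x ε≤y ⟩
    y ∙ x  ∎

  x≤y⇒ε≤y-x : ∀ {x y} → x ≤ᴳ y → ε ≤ᴳ y - x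
  x≤y⇒ε≤y-x {x} {y} x≤y = begin
    ε      ≈⟨ inverseʳ x ⟨
    x - x  ≤⟨ ∙-mono-≤ (x ⁻¹) x≤y ⟩
    y - x  ∎

  ε≤y-x⇒x≤y : ∀ {x y} → ε ≤ᴳ y - x → x ≤ᴳ y
  ε≤y-x⇒x≤y {x} {y} ε≤y-x = begin
    x            ≈⟨ identityˡ x ⟨
    ε ∙ x        ≤⟨ ∙-mono-≤ x ε≤y-x ⟩
    (y - x) ∙ x  ≈⟨ //-rightDividesˡ x y ⟩
    y            ∎

  ⁻¹-antimono-≤ : ∀ {x y} → x ≤ᴳ y → y ⁻¹ ≤ᴳ x ⁻¹
  ⁻¹-antimono-≤ {x} {y} x≤y = begin
    y ⁻¹              ≈⟨ identityˡ (y ⁻¹) ⟨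
    ε ∙ y ⁻¹          ≤⟨ ∙-mono-≤ (y ⁻¹) (x≤y⇒ε≤y-x x≤y) ⟩
    (y - x) ∙ y ⁻¹    ≈⟨ xyx⁻¹≈y y (x ⁻¹) ⟩
    x ⁻¹              ∎

  [y-x]∙[z-y]≈z-x : ∀ x y z → (y - x) ∙ (z - y) ≈ z - x
  [y-x]∙[z-y]≈z-x x y z = begin-equality
    (y - x) ∙ (z - y)        ≈⟨ comm (y - x) (z - y) ⟩
    (z - y) ∙ (y - x)        ≈⟨ assoc z (y ⁻¹) (y - x) ⟩
    z ∙ (y ⁻¹ ∙ (y - x))     ≈⟨ ∙-congˡ (\\-leftDividesʳ y (x ⁻¹)) ⟩
    z - x                    ∎

module Sums {a ℓ₁ ℓ₂ : Level} (G : OrderedAbelianGroup a ℓ₁ ℓ₂) where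
  open OrderedAbelianGroupProperties G

  ΣG-cong : ∀ n {F H : Fin n → Carrier} → (∀ i → F i ≈ H i) → ΣG G n F ≈ ΣG G n H
  ΣG-cong zero    F≈H = refl
  ΣG-cong (suc n) F≈H = ∙-cong (F≈H zero) (ΣG-cong n (F≈H ∘ suc))

  ΣG-mono-≤ : ∀ n {F H : Fin n → Carrier} → (∀ i → F i ≤ᴳ H i) → ΣG G n F ≤ᴳ ΣG G n H
  ΣG-mono-≤ zero    F≤H = ≤ᴳ-refl
  ΣG-mono-≤ (suc n) F≤H = ∙-mono₂-≤ (F≤H zero) (ΣG-mono-≤ n (F≤H ∘ suc))

  ΣG-ε : ∀ n → ΣG G n (λ _ → ε) ≈ ε
  ΣG-ε zero    = refl
  ΣG-ε (suc n) = trans (∙-congˡ (ΣG-ε n)) (identityʳ ε)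

  ΣG-distrib-∙ : ∀ n (F H : Fin n → Carrier) → ΣG G n (λ i → F i ∙ H i) ≈ ΣG G n F ∙ ΣG G n H
  ΣG-distrib-∙ zero    F H = sym (identityʳ ε)
  ΣG-distrib-∙ (suc n) F H =
    trans (∙-congˡ (ΣG-distrib-∙ n (F ∘ suc) (H ∘ suc))) (interchange (F zero) (H zero) _ _)

  ΣG-distrib-⁻¹ : ∀ n (F : Fin n → Carrier) → ΣG G n (λ i → F i ⁻¹) ≈ ΣG G n F ⁻¹
  ΣG-distrib-⁻¹ zero    F = sym ε⁻¹≈ε
  ΣG-distrib-⁻¹ (suc n) F = trans (∙-congˡ (ΣG-distrib-⁻¹ n (F ∘ suc))) (⁻¹-∙-comm (F zero) _)

  ΣG-distrib-- : ∀ n (F H : Fin n → Carrier) → ΣG G n (λ i → F i - H i) ≈ ΣG G n F - ΣG G n H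
  ΣG-distrib-- n F H = trans (ΣG-distrib-∙ n F (λ i → H i ⁻¹)) (∙-congˡ (ΣG-distrib-⁻¹ n H))

  selectedSum : ∀ k → (Fin k → Bool) → (ℕ → Carrier) → Carrier
  selectedSum k x a = ΣG G k (λ j → if x j then a (toℕ j) else ε)

  selectedSum-initialSegment : ∀ k {m} (a : ℕ → Carrier) → m ℕ.≤ k →
                               selectedSum k (initialSegment m) a ≈ ΣG G m (a ∘ toℕ)
  selectedSum-initialSegment k       a z≤n       = ΣG-ε k
  selectedSum-initialSegment (suc k) a (s≤s m≤k) = ∙-congˡ (selectedSum-initialSegment k (a ∘ suc) m≤k)

  ΣG-prefix≤selectedSum : ∀ {k} (a : ℕ → Carrier) → (∀ j → a j ≤ᴳ a (suc j)) →
                           (x : Fin k → Bool) → ΣG G (trues x) (a ∘ toℕ) ≤ᴳ selectedSum k x a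
  ΣG-prefix≤selectedSum {zero}  a a↑ x = ≤ᴳ-refl
  ΣG-prefix≤selectedSum {suc k} a a↑ x with x zero
  ... | true  = ∙-mono₂-≤ ≤ᴳ-refl (ΣG-prefix≤selectedSum (a ∘ suc) (a↑ ∘ suc) (x ∘ suc))
  ... | false = begin
    ΣG G (trues (x ∘ suc)) (a ∘ toℕ)
      ≤⟨ ΣG-mono-≤ (trues (x ∘ suc)) (a↑ ∘ toℕ) ⟩
    ΣG G (trues (x ∘ suc)) (a ∘ suc ∘ toℕ)
      ≤⟨ ΣG-prefix≤selectedSum (a ∘ suc) (a↑ ∘ suc) (x ∘ suc) ⟩
    selectedSum k (x ∘ suc) (a ∘ suc)
      ≈⟨ identityˡ _ ⟨
    ε ∙ selectedSum k (x ∘ suc) (a ∘ suc) ∎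

module Linearisation {a ℓ₁ ℓ₂ : Level} (G : OrderedAbelianGroup a ℓ₁ ℓ₂) where
  open OrderedAbelianGroupProperties G
  open Sums G

  Δ⁺ : (ℤ → Carrier) → ℕ → Carrier
  Δ⁺ g j = Δ G g (+ j)

  rise : (ℤ → Carrier) → ℕ → Carrier
  rise g m = g (+ m) - g 0ℤ

  ΣΔ⁺≈rise : ∀ g m → ΣG G m (Δ⁺ g ∘ toℕ) ≈ rise g m
  ΣΔ⁺≈rise g zero    = sym (inverseʳ (g 0ℤ))
  ΣΔ⁺≈rise g (suc m) = trans (∙-congˡ (ΣΔ⁺≈rise (λ t → g (1ℤ ℤ.+ t)) m))
                             ([y-x]∙[z-y]≈z-x (g 0ℤ) (g 1ℤ) (g (+ suc m)))

  record ConvexNondecreasingOnℕ (g : ℤ → Carrier) : Set ℓ₂ where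
    field
      Δ⁺-nondecreasing : ∀ j → Δ⁺ g j ≤ᴳ Δ⁺ g (suc j)
      Δ⁺-nonnegative   : ∀ j → ε ≤ᴳ Δ⁺ g j

    nondecreasing : ∀ {m n} → m ℕ.≤ n → g (+ m) ≤ᴳ g (+ n)
    nondecreasing m≤n = go (ℕ.≤⇒≤′ m≤n)
      where
      step : ∀ j → g (+ j) ≤ᴳ g (+ suc j)
      step j = ≡.subst (λ t → g (+ j) ≤ᴳ g (+ t)) (ℕ.+-comm j 1) (ε≤y-x⇒x≤y (Δ⁺-nonnegative j))

      go : ∀ {m n} → m ≤′ n → g (+ m) ≤ᴳ g (+ n)
      go ≤′-refl                     = ≤ᴳ-refl
      go {m} {suc n} (≤′-step m≤′n) = begin
        g (+ m)      ≤⟨ go m≤′n ⟩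
        g (+ n)      ≤⟨ step n ⟩
        g (+ suc n)  ∎

    rise-nonnegative : ∀ m → ε ≤ᴳ rise g m
    rise-nonnegative m = x≤y⇒ε≤y-x (nondecreasing z≤n)

  open ConvexNondecreasingOnℕ

  module _ {g : ℤ → Carrier} (conv : ZConvexMin0 G g) where
    open ZConvexMin0 conv

    ZConvexMin0⇒ConvexNondecreasingOnℕ : ConvexNondecreasingOnℕ g
    ZConvexMin0⇒ConvexNondecreasingOnℕ = record
      { Δ⁺-nondecreasing = λ j → increasing (+ j) (+ suc j) (+≤+ (ℕ.n≤1+n j))
      ; Δ⁺-nonnegative   = λ j → nonneg-nonneg (+ j) (+≤+ z≤n)
      }

    Δ⁺-reflect : ∀ j → Δ⁺ (g ∘ -_) j ≈ Δ G g -[1+ j ] ⁻¹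
    Δ⁺-reflect j = begin-equality
      g (- (+ j ℤ.+ 1ℤ)) - g (- + j)
        ≡⟨ ≡.cong₂ (λ u v → g u - g v) (≡.cong (λ t → - + t) (ℕ.+-comm j 1)) (≡.sym (ℤ.1-[1+n]≡-n j)) ⟩
      g -[1+ j ] - g (-[1+ j ] ℤ.+ 1ℤ)
        ≈⟨ ⁻¹-anti-homo‿- _ _ ⟨
      Δ G g -[1+ j ] ⁻¹ ∎

    ZConvexMin0⇒ConvexNondecreasingOnℕ-reflected : ConvexNondecreasingOnℕ (g ∘ -_)
    ZConvexMin0⇒ConvexNondecreasingOnℕ-reflected = record
      { Δ⁺-nondecreasing = λ j → begin
          Δ⁺ (g ∘ -_) j            ≈⟨ Δ⁺-reflect j ⟩
          Δ G g -[1+ j ] ⁻¹        ≤⟨ ⁻¹-antimono-≤ (increasing _ _ (-≤- (ℕ.n≤1+n j))) ⟩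
          Δ G g -[1+ suc j ] ⁻¹    ≈⟨ Δ⁺-reflect (suc j) ⟨
          Δ⁺ (g ∘ -_) (suc j)      ∎
      ; Δ⁺-nonnegative   = λ j → begin
          ε                        ≈⟨ ε⁻¹≈ε ⟨
          ε ⁻¹                     ≤⟨ ⁻¹-antimono-≤ (nonpos-neg -[1+ j ] -<+) ⟩
          Δ G g -[1+ j ] ⁻¹        ≈⟨ Δ⁺-reflect j ⟨
          Δ⁺ (g ∘ -_) j            ∎
      }

  module _ {g : ℤ → Carrier} (g⁺ : ConvexNondecreasingOnℕ g) (g⁻ : ConvexNondecreasingOnℕ (g ∘ -_)) where

    rise-⊖ : ∀ p q → g (p ⊖ q) - g 0ℤ ≤ᴳ rise g p ∙ rise (g ∘ -_) q
    rise-⊖ p q with ℕ.≤-total q p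
    ... | inj₁ q≤p = begin
      g (p ⊖ q) - g 0ℤ            ≡⟨ ≡.cong (λ t → g t - g 0ℤ) (ℤ.⊖-≥ q≤p) ⟩
      rise g (p ∸ q)              ≤⟨ ∙-mono-≤ _ (nondecreasing g⁺ (ℕ.m∸n≤m p q)) ⟩
      rise g p                    ≤⟨ x≤x∙y (rise-nonnegative g⁻ q) ⟩
      rise g p ∙ rise (g ∘ -_) q  ∎
    ... | inj₂ p≤q = begin
      g (p ⊖ q) - g 0ℤ            ≡⟨ ≡.cong (λ t → g t - g 0ℤ) (ℤ.⊖-≤ p≤q) ⟩
      rise (g ∘ -_) (q ∸ p)       ≤⟨ ∙-mono-≤ _ (nondecreasing g⁻ (ℕ.m∸n≤m q p)) ⟩
      rise (g ∘ -_) q             ≤⟨ x≤y∙x (rise-nonnegative g⁺ p) ⟩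
      rise g p ∙ rise (g ∘ -_) q  ∎

  -- Problem.objective x y unfolds to ΣG G s (λ i → stepCost k (f i) (x i) (y i)) ∙ cz.
  stepCost : ∀ k → (ℤ → Carrier) → (Fin k → Bool) → (Fin k → Bool) → Carrier
  stepCost k g x y = ΣG G k (λ j →
    (if x j then Δ⁺ g (toℕ j) else ε) ∙ (if y j then Δ⁺ (g ∘ -_) (toℕ j) else ε))

  stepCost≈selectedSums : ∀ k g (x y : Fin k → Bool) →
                          stepCost k g x y ≈ selectedSum k x (Δ⁺ g) ∙ selectedSum k y (Δ⁺ (g ∘ -_))
  stepCost≈selectedSums k g x y = ΣG-distrib-∙ k _ _

  stepCost-initialSegments : ∀ k g {p q} → p ℕ.≤ k → q ℕ.≤ k →
    stepCost k g (initialSegment p) (initialSegment q) ≈ rise g p ∙ rise (g ∘ -_) q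
  stepCost-initialSegments k g {p} {q} p≤k q≤k = begin-equality
    stepCost k g (initialSegment p) (initialSegment q)
      ≈⟨ stepCost≈selectedSums k g (initialSegment p) (initialSegment q) ⟩
    selectedSum k (initialSegment p) (Δ⁺ g) ∙ selectedSum k (initialSegment q) (Δ⁺ (g ∘ -_))
      ≈⟨ ∙-cong (selectedSum-initialSegment k (Δ⁺ g) p≤k)
                (selectedSum-initialSegment k (Δ⁺ (g ∘ -_)) q≤k) ⟩
    ΣG G p (Δ⁺ g ∘ toℕ) ∙ ΣG G q (Δ⁺ (g ∘ -_) ∘ toℕ)
      ≈⟨ ∙-cong (ΣΔ⁺≈rise g p) (ΣΔ⁺≈rise (g ∘ -_) q) ⟩
    rise g p ∙ rise (g ∘ -_) q ∎

  stepCost-steps : ∀ k g L → ∣ L ∣ ℕ.≤ k →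
                   stepCost k g (positiveSteps L) (negativeSteps L) ≈ g L - g 0ℤ
  stepCost-steps k g (+ m) m≤k = begin-equality
    stepCost k g (initialSegment m) (initialSegment 0)  ≈⟨ stepCost-initialSegments k g m≤k z≤n ⟩
    rise g m ∙ rise (g ∘ -_) 0                          ≈⟨ ∙-congˡ (inverseʳ (g 0ℤ)) ⟩
    rise g m ∙ ε                                        ≈⟨ identityʳ _ ⟩
    rise g m                                            ∎
  stepCost-steps k g -[1+ m ] m<k = begin-equality
    stepCost k g (initialSegment 0) (initialSegment (suc m))  ≈⟨ stepCost-initialSegments k g z≤n m<k ⟩
    rise g 0 ∙ rise (g ∘ -_) (suc m)                          ≈⟨ ∙-congʳ (inverseʳ (g 0ℤ)) ⟩
    ε ∙ rise (g ∘ -_) (suc m)                                 ≈⟨ identityˡ _ ⟩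
    rise (g ∘ -_) (suc m)                                     ∎

  stepCost-≥ : ∀ {g} k {L} {x y : Fin k → Bool} → ZConvexMin0 G g →
               L ≡ count k x ℤ.- count k y → g L - g 0ℤ ≤ᴳ stepCost k g x y
  stepCost-≥ {g} k {L} {x} {y} conv L≡x-y = begin
    g L - g 0ℤ
      ≡⟨ ≡.cong (λ t → g t - g 0ℤ) L≡p⊖q ⟩
    g (p ⊖ q) - g 0ℤ
      ≤⟨ rise-⊖ g⁺ g⁻ p q ⟩
    rise g p ∙ rise (g ∘ -_) q
      ≈⟨ ∙-cong (ΣΔ⁺≈rise g p) (ΣΔ⁺≈rise (g ∘ -_) q) ⟨
    ΣG G p (Δ⁺ g ∘ toℕ) ∙ ΣG G q (Δ⁺ (g ∘ -_) ∘ toℕ)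
      ≤⟨ ∙-mono₂-≤ (ΣG-prefix≤selectedSum _ (Δ⁺-nondecreasing g⁺) x)
                   (ΣG-prefix≤selectedSum _ (Δ⁺-nondecreasing g⁻) y) ⟩
    selectedSum k x (Δ⁺ g) ∙ selectedSum k y (Δ⁺ (g ∘ -_))
      ≈⟨ stepCost≈selectedSums k g x y ⟨
    stepCost k g x y ∎
    where
    p q : ℕ
    p = trues x
    q = trues y

    g⁺ : ConvexNondecreasingOnℕ g
    g⁺ = ZConvexMin0⇒ConvexNondecreasingOnℕ conv

    g⁻ : ConvexNondecreasingOnℕ (g ∘ -_)
    g⁻ = ZConvexMin0⇒ConvexNondecreasingOnℕ-reflected conv

    L≡p⊖q : L ≡ p ⊖ q
    L≡p⊖q = ≡.trans L≡x-y
      (≡.trans (≡.cong₂ ℤ._-_ (count≡trues k x) (count≡trues k y)) (ℤ.m-n≡m⊖n p q))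

lemma3p6 : ∀ {a ℓ₁ ℓ₂} (G : OrderedAbelianGroup a ℓ₁ ℓ₂)
    (d n s : ℕ)
    (f : Fin s → ℤ → OrderedAbelianGroup.Carrier G)
    (fconv : ∀ i → ZConvexMin0 G (f i))
    (A : Fin d → Fin n → ℤ) (b : Fin d → ℤ)
    (c : Fin n → OrderedAbelianGroup.Carrier G)
    (C : Fin s → Fin n → ℤ) (C0 : Fin s → ℤ)
    (z : Fin n → ℕ)
    (Az≡b : ∀ r → linForm n (A r) (+ 0) z ≡ b r)
    (k : ℕ)
    (k≥ : ∀ i → ∣ linForm n (C i) (C0 i) z ∣ Data.Nat.≤ k) →
    Problem.OptimalValueIs G n s k f c C C0 z (Problem.target G n s k f c C C0 z)
-- The constraint Az = b only records that z is feasible.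
lemma3p6 G d n s f fconv A b c C C0 z _ k k≥ = (x₀ , y₀ , feasible₀ , optimal₀) , lowerBound
  where
  open OrderedAbelianGroupProperties G
  open Sums G
  open Linearisation G
  open Problem G n s k f c C C0 z

  L : Fin s → ℤ
  L i = linForm n (C i) (C0 i) z

  x₀ y₀ : Fin s → Fin k → Bool
  x₀ i = positiveSteps (L i)
  y₀ i = negativeSteps (L i)

  feasible₀ : feasible x₀ y₀
  feasible₀ i = count-steps (L i) (k≥ i)

  Σrise≈target : ΣG G s (λ i → f i (L i) - f i 0ℤ) ∙ cz ≈ target
  Σrise≈target = begin-equality
    ΣG G s (λ i → f i (L i) - f i 0ℤ) ∙ cz                  ≈⟨ ∙-congʳ (ΣG-distrib-- s _ _) ⟩
    (ΣG G s (λ i → f i (L i)) - ΣG G s (λ i → f i 0ℤ)) ∙ cz  ≈⟨ xy∙z≈xz∙y _ _ _ ⟨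
    target                                                  ∎

  optimal₀ : objective x₀ y₀ ≈ target
  optimal₀ = begin-equality
    ΣG G s (λ i → stepCost k (f i) (x₀ i) (y₀ i)) ∙ cz
      ≈⟨ ∙-congʳ (ΣG-cong s (λ i → stepCost-steps k (f i) (L i) (k≥ i))) ⟩
    ΣG G s (λ i → f i (L i) - f i 0ℤ) ∙ cz
      ≈⟨ Σrise≈target ⟩
    target ∎

  lowerBound : ∀ x y → feasible x y → target ≤ᴳ objective x y
  lowerBound x y feasible-xy = begin
    target
      ≈⟨ Σrise≈target ⟨
    ΣG G s (λ i → f i (L i) - f i 0ℤ) ∙ cz
      ≤⟨ ∙-mono-≤ cz (ΣG-mono-≤ s (λ i → stepCost-≥ k (fconv i) (feasible-xy i))) ⟩
    objective x y ∎
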